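{- For every odd prime $p > 3$, the group $H_{4p}$ is uncollapsed.
   Context: For a positive integer $m$, $H_m = \langle a,b,c \mid a^2,b^2,c^2,(ab)^3,(ac)^2,(bc)^m,(bac)^m\rangle$. We write $H_m = H_k$ if the two presentations define the same quotient of the free group on $a,b,c$ (the normal closures of the relator sets coincide). $H_m$ is uncollapsed if $H_m \neq H_k$ for all integers $1\le k<m$. -}

module Defs where

open import Data.Nat using (ℕ; zero; suc; _≤_; _<_)
open import Data.Fin using (Fin; zero; suc)
open import Data.Bool using (Bool; true; false; not)
open import Data.Product using (_×_; _,_)
open import Data.List using (List; []; _∷_; _++_; map; reverse)
open import Data.List.Membership.Propositional using (_∈_)
open import Relation.Nullary using (¬_)

-- Words in the free group on three generators a, b, c.
-- A letter is (generator index , exponent sign): true = x, false = x⁻¹.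
Letter : Set
Letter = Fin 3 × Bool

Word : Set
Word = List Letter

invL : Letter → Letter
invL (x , s) = (x , not s)

inv : Word → Word
inv w = reverse (map invL w)

data _≈F_ : Word → Word → Set where
  ≈-refl  : ∀ {u} → u ≈F u
  ≈-sym   : ∀ {u v} → u ≈F v → v ≈F u
  ≈-trans : ∀ {u v w} → u ≈F v → v ≈F w → u ≈F w
  ≈-cancel : ∀ u x v → (u ++ (x ∷ invL x ∷ v)) ≈F (u ++ v)

data InNC (R : List Word) : Word → Set where
  nc-one  : InNC R []
  nc-rel  : ∀ {r} → r ∈ R → InNC R r
  nc-mul  : ∀ {u v} → InNC R u → InNC R v → InNC R (u ++ v)
  nc-inv  : ∀ {u} → InNC R u → InNC R (inv u)
  nc-conj : ∀ g {u} → InNC R u → InNC R (g ++ (u ++ inv g))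
  nc-resp : ∀ {u v} → u ≈F v → InNC R u → InNC R v

SameQuotient : List Word → List Word → Set
SameQuotient R S = ∀ w → (InNC R w → InNC S w) × (InNC S w → InNC R w)

a b c : Word
a = (zero , true) ∷ []
b = (suc zero , true) ∷ []
c = (suc (suc zero) , true) ∷ []

_^w_ : Word → ℕ → Word
w ^w zero = []
w ^w suc n = w ++ (w ^w n)

relH : ℕ → List Word
relH m = (a ^w 2) ∷ (b ^w 2) ∷ (c ^w 2) ∷ ((a ++ b) ^w 3) ∷ ((a ++ c) ^w 2)
       ∷ ((b ++ c) ^w m) ∷ ((b ++ (a ++ c)) ^w m) ∷ []

SameH : ℕ → ℕ → Set
SameH m k = SameQuotient (relH m) (relH k)

Uncollapsed : ℕ → Set
Uncollapsed m = ∀ k → 1 ≤ k → k < m → ¬ SameH m k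

module Submission where

-- H_n ≠ H_k (1 ≤ k < n) is witnessed by a permutation action of
-- the free group on a, b, c in which every relator of H_n acts trivially but
-- (bc)^k does not: if H_n = H_k then (bc)^k lies in the normal closure of the
-- relators of H_n, and such words act trivially.
--
-- For every m we then build an explicit action on
-- 8m + 20 points (module Representation) satisfying the relators of H_n with
-- n = 8m + 20 = 4(2m + 5), in which both bc and bac are single n-cycles.
-- This shows that H_{4q} is uncollapsed for every odd q ≥ 5, and the theorem
-- follows because a prime p > 3 is odd.

open import Defs
open import Data.Nat using (ℕ; _<_; _*_)
open import Data.Nat.Primality using (Prime)

open import Data.Nat using (zero; suc; _+_; _≤_; s≤s; _≟_)
open import Data.Nat.Properties using (+-suc; +-comm; +-identityʳ; suc-injective; <-irrefl; <⇒≤; m<n⇒m<1+n)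
open import Data.Nat.Primality using (composite)
open import Data.Nat.Divisibility using (divides)
open import Data.Nat.GeneralisedArithmetic using (iterate)
open import Data.Nat.Tactic.RingSolver using (solve-∀)
open import Data.Fin using (Fin; zero; suc)
open import Data.Product using (_×_; _,_; proj₁; proj₂; ∃)
open import Data.Sum using (_⊎_; inj₁; inj₂)
open import Data.List using ([]; _∷_; _++_; map)
open import Data.List.Properties using (unfold-reverse)
open import Data.List.Membership.Propositional using (_∈_)
open import Data.List.Relation.Unary.Any using (here; there)
open import Relation.Nullary using (contradiction)
open import Relation.Nullary.Decidable using (recompute)
open import Relation.Binary.PropositionalEquality
open ≡-Reasoning

-- An action of the free group F(a,b,c) on a type P, given by assigning an
-- involution of P to each generator.  Words act on the right: the first
-- letter of a word acts first.
module Action {P : Set} (act : Fin 3 → P → P)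
               (act-invol : ∀ i x → act i (act i x) ≡ x) where

  -- x and x⁻¹ act alike, since every generator acts as an involution
  actL : Letter → P → P
  actL (i , _) = act i

  ev : Word → P → P
  ev [] x = x
  ev (l ∷ w) x = ev w (actL l x)

  ev-++ : ∀ u v x → ev (u ++ v) x ≡ ev v (ev u x)
  ev-++ [] v x = refl
  ev-++ (l ∷ u) v x = ev-++ u v (actL l x)

  ev-^w : ∀ w n x → ev (w ^w n) x ≡ iterate (ev w) x n
  ev-^w w zero x = refl
  ev-^w w (suc n) x = trans (ev-++ w (w ^w n) x) (ev-^w w n (ev w x))

  ev-inv-∷ : ∀ l w x → ev (inv (l ∷ w)) x ≡ actL l (ev (inv w) x)
  ev-inv-∷ l w x =
    trans (cong (λ u → ev u x) (unfold-reverse (invL l) (map invL w)))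
          (ev-++ (inv w) (invL l ∷ []) x)

  ev-inv-left : ∀ w x → ev (inv w) (ev w x) ≡ x
  ev-inv-left [] x = refl
  ev-inv-left (l ∷ w) x = begin
    ev (inv (l ∷ w)) (ev w (actL l x))    ≡⟨ ev-inv-∷ l w _ ⟩
    actL l (ev (inv w) (ev w (actL l x))) ≡⟨ cong (actL l) (ev-inv-left w (actL l x)) ⟩
    actL l (actL l x)                     ≡⟨ act-invol (proj₁ l) x ⟩
    x                                     ∎

  ev-inv-right : ∀ w x → ev w (ev (inv w) x) ≡ x
  ev-inv-right [] x = refl
  ev-inv-right (l ∷ w) x = begin
    ev w (actL l (ev (inv (l ∷ w)) x))    ≡⟨ cong (λ z → ev w (actL l z)) (ev-inv-∷ l w x) ⟩
    ev w (actL l (actL l (ev (inv w) x))) ≡⟨ cong (ev w) (act-invol (proj₁ l) _) ⟩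
    ev w (ev (inv w) x)                   ≡⟨ ev-inv-right w x ⟩
    x                                     ∎

  ≈F-sound : ∀ {u w} → u ≈F w → ∀ x → ev u x ≡ ev w x
  ≈F-sound ≈-refl x = refl
  ≈F-sound (≈-sym e) x = sym (≈F-sound e x)
  ≈F-sound (≈-trans e e′) x = trans (≈F-sound e x) (≈F-sound e′ x)
  ≈F-sound (≈-cancel u l w) x = begin
    ev (u ++ (l ∷ invL l ∷ w)) x  ≡⟨ ev-++ u _ x ⟩
    ev w (actL l (actL l (ev u x))) ≡⟨ cong (ev w) (act-invol (proj₁ l) _) ⟩
    ev w (ev u x)                 ≡⟨ ev-++ u w x ⟨
    ev (u ++ w) x                 ∎

  ActsTrivially : Word → Set
  ActsTrivially w = ∀ x → ev w x ≡ x

  normal-closure-trivial : ∀ {R} → (∀ r → r ∈ R → ActsTrivially r) →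
                           ∀ {w} → InNC R w → ActsTrivially w
  normal-closure-trivial R-triv nc-one x = refl
  normal-closure-trivial R-triv (nc-rel {r} r∈R) = R-triv r r∈R
  normal-closure-trivial R-triv (nc-mul {u} {w} p q) x = begin
    ev (u ++ w) x ≡⟨ ev-++ u w x ⟩
    ev w (ev u x) ≡⟨ cong (ev w) (normal-closure-trivial R-triv p x) ⟩
    ev w x        ≡⟨ normal-closure-trivial R-triv q x ⟩
    x             ∎
  normal-closure-trivial R-triv (nc-inv {u} p) x = begin
    ev (inv u) x                   ≡⟨ cong (ev (inv u)) (normal-closure-trivial R-triv p x) ⟨
    ev (inv u) (ev u x)            ≡⟨ ev-inv-left u x ⟩
    x                              ∎
  normal-closure-trivial R-triv (nc-conj g {u} p) x = begin
    ev (g ++ (u ++ inv g)) x   ≡⟨ ev-++ g _ x ⟩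
    ev (u ++ inv g) (ev g x)   ≡⟨ ev-++ u _ _ ⟩
    ev (inv g) (ev u (ev g x)) ≡⟨ cong (ev (inv g)) (normal-closure-trivial R-triv p _) ⟩
    ev (inv g) (ev g x)        ≡⟨ ev-inv-left g x ⟩
    x                          ∎
  normal-closure-trivial R-triv (nc-resp e p) x =
    trans (sym (≈F-sound e x)) (normal-closure-trivial R-triv p x)

  uncollapsed-by-action : ∀ n → (∀ r → r ∈ relH n → ActsTrivially r) →
    (x : P) → (∀ k → 1 ≤ k → k < n → iterate (ev (b ++ c)) x k ≢ x) →
    Uncollapsed n
  uncollapsed-by-action n relators x returns-late k 1≤k k<n same =
    returns-late k 1≤k k<n (begin
      iterate (ev (b ++ c)) x k ≡⟨ ev-^w (b ++ c) k x ⟨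
      ev ((b ++ c) ^w k) x      ≡⟨ normal-closure-trivial relators bcᵏ∈Hₙ x ⟩
      x                         ∎)
    where
      bcᵏ∈Hₖ : InNC (relH k) ((b ++ c) ^w k)
      bcᵏ∈Hₖ = nc-rel (there (there (there (there (there (here refl))))))
      bcᵏ∈Hₙ : InNC (relH n) ((b ++ c) ^w k)
      bcᵏ∈Hₙ = proj₂ (same ((b ++ c) ^w k)) bcᵏ∈Hₖ

iterate-suc : ∀ {P : Set} (f : P → P) n x → iterate f x (suc n) ≡ f (iterate f x n)
iterate-suc f zero x = refl
iterate-suc f (suc n) x = iterate-suc f n (f x)

iterate-+ : ∀ {P : Set} (f : P → P) m n x →
            iterate f x (m + n) ≡ iterate f (iterate f x m) n
iterate-+ f zero n x = refl
iterate-+ f (suc m) n x = iterate-+ f m n (f x)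

-- Measuring an orbit of a permutation f (with inverse g) by a labelling q of
-- its points with step numbers: q is 0 at start, every point other than last
-- is sent by f to a point labelled one higher, and f sends last back to start.
module LabelledCycle {P : Set} (f g : P → P) (f∘g : ∀ x → f (g x) ≡ x)
  (q : P → ℕ) (start last : P) (q-start : q start ≡ 0)
  (q-step : ∀ x → x ≡ last ⊎ q (f x) ≡ suc (q x))
  (f-last : f last ≡ start) where

  length : ℕ
  length = suc (q last)

  step-back : ∀ y → y ≡ start ⊎ q y ≡ suc (q (g y))
  step-back y with q-step (g y)
  ... | inj₁ gy≡last = inj₁ (begin
        y        ≡⟨ f∘g y ⟨
        f (g y)  ≡⟨ cong f gy≡last ⟩
        f last   ≡⟨ f-last ⟩
        start    ∎)
  ... | inj₂ step = inj₂ (trans (cong q (sym (f∘g y))) step)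

  reach : ∀ n y → q y ≡ n → iterate f start n ≡ y
  reach n y qy≡n with step-back y
  reach zero y _ | inj₁ y≡start = sym y≡start
  reach (suc n) y qy≡n | inj₁ refl = contradiction (trans (sym q-start) qy≡n) λ ()
  reach zero y qy≡0 | inj₂ step = contradiction (trans (sym step) qy≡0) λ ()
  reach (suc n) y qy≡n | inj₂ step = begin
    iterate f start (suc n) ≡⟨ iterate-suc f n start ⟩
    f (iterate f start n)   ≡⟨ cong f (reach n (g y) (suc-injective (trans (sym step) qy≡n))) ⟩
    f (g y)                 ≡⟨ f∘g y ⟩
    y                       ∎

  closes : iterate f start length ≡ start
  closes = begin
    iterate f start (suc (q last)) ≡⟨ iterate-suc f (q last) start ⟩
    f (iterate f start (q last))   ≡⟨ cong f (reach (q last) last refl) ⟩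
    f last                         ≡⟨ f-last ⟩
    start                          ∎

  period : ∀ y → iterate f y length ≡ y
  period y = begin
    iterate f y length                          ≡⟨ cong (λ z → iterate f z length) (reach (q y) y refl) ⟨
    iterate f (iterate f start (q y)) length    ≡⟨ iterate-+ f (q y) length start ⟨
    iterate f start (q y + length)              ≡⟨ cong (iterate f start) (+-comm (q y) length) ⟩
    iterate f start (length + q y)              ≡⟨ iterate-+ f length (q y) start ⟩
    iterate f (iterate f start length) (q y)    ≡⟨ cong (λ z → iterate f z (q y)) closes ⟩
    iterate f start (q y)                       ≡⟨ reach (q y) y refl ⟩
    y                                           ∎

  label-counts : ∀ t → t < length → q (iterate f start t) ≡ t
  label-counts zero _ = q-start
  label-counts (suc t) (s≤s t<qlast)
    with q-step (iterate f start t) | label-counts t (m<n⇒m<1+n t<qlast)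
  ... | inj₁ at-last | ih = contradiction t<qlast (<-irrefl (sym (trans (cong q (sym at-last)) ih)))
  ... | inj₂ step    | ih = trans (cong q (iterate-suc f t start)) (trans step (cong suc ih))

  returns-late : ∀ t → 1 ≤ t → t < length → iterate f start t ≢ start
  returns-late (suc t) _ t<length back
    with trans (sym (label-counts (suc t) t<length)) (trans (cong q back) q-start)
  ... | ()

module Zigzag (x₀ y₀ : ℕ) where
  zigF zigR : ℕ → ℕ
  zigF zero = x₀
  zigF (suc j) = suc (zigR j)
  zigR zero = y₀
  zigR (suc j) = 3 + zigF j

  zig-double : ∀ k → zigF (k + k) ≡ k * 4 + x₀ × zigR (k + k) ≡ k * 4 + y₀
  zig-double zero = refl , refl
  zig-double (suc k) rewrite +-suc k k =
    cong (4 +_) (proj₁ (zig-double k)) , cong (4 +_) (proj₂ (zig-double k))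

-- The points of the action used for H_{8m+20}: four strands F₀ F₁ R₀ R₁ of
-- m + 1 points and four strands G₀ … G₃ of m points, a strand point carrying
-- its position j and its distance d from the end of the strand, together with
-- sixteen single points; 8m + 20 points in all.  The side conditions are
-- irrelevant, so points with the same coordinates are equal.
data Point (m : ℕ) : Set where
  s₀ s₁ s₂ t : Point m
  F₀ F₁ R₀ R₁ : (j d : ℕ) → .(j + d ≡ m) → Point m
  G₀ G₁ G₂ G₃ : (j d : ℕ) → .(suc (j + d) ≡ m) → Point m
  M₀ M₁ M₂ M₃ M₄ M₅ M₆ M₇ M₈ M₉ M₁₀ M₁₁ : Point m

strand-≡ : ∀ {m j j′ d d′} (K : (j d : ℕ) → .(j + d ≡ m) → Point m)
           .{e : j + d ≡ m} .{e′ : j′ + d′ ≡ m} →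
           j ≡ j′ → d ≡ d′ → K j d e ≡ K j′ d′ e′
strand-≡ K refl refl = refl

-- at the ends of a strand the irrelevant side condition determines the
-- remaining coordinate (equality of numbers is decidable, so it is recomputable)
first-on-strand : ∀ {m d} → .(0 + d ≡ m) → m ≡ d
first-on-strand e = sym (recompute (_ ≟ _) e)

last-on-strand : ∀ {m j} → .(j + 0 ≡ m) → m ≡ j
last-on-strand {j = j} e = sym (trans (sym (+-identityʳ j)) (recompute (_ ≟ _) e))

module Representation (m : ℕ) where

  A B C : Point m → Point m
  A s₀ = t
  A t = s₀
  A s₁ = s₂
  A s₂ = s₁
  A (F₀ j d e) = R₀ j d e
  A (F₁ j d e) = R₁ j d e
  A (R₀ j d e) = F₀ j d e
  A (R₁ j d e) = F₁ j d e
  A (G₀ j d e) = G₃ j d e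
  A (G₁ j d e) = G₂ j d e
  A (G₂ j d e) = G₁ j d e
  A (G₃ j d e) = G₀ j d e
  A M₀ = M₄
  A M₄ = M₀
  A M₁ = M₅
  A M₅ = M₁
  A M₂ = M₁₀
  A M₁₀ = M₂
  A M₃ = M₁₁
  A M₁₁ = M₃
  A M₆ = M₉
  A M₉ = M₆
  A M₇ = M₈
  A M₈ = M₇

  B s₀ = s₁
  B s₁ = s₀
  B s₂ = F₀ 0 m refl
  B t = R₀ 0 m refl
  B (F₀ zero d e) = s₂
  B (F₀ (suc j) d e) = G₃ j d e
  B (F₁ j zero e) = M₀
  B (F₁ j (suc d) e) = G₀ j d (trans (sym (+-suc j d)) e)
  B (G₀ j d e) = F₁ j (suc d) (trans (+-suc j d) e)
  B (G₁ j d e) = G₂ j d e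
  B (G₂ j d e) = G₁ j d e
  B (G₃ j d e) = F₀ (suc j) d e
  B (R₀ zero d e) = t
  B (R₀ (suc j) d e) = R₁ j (suc d) (trans (+-suc j d) e)
  B (R₁ j zero e) = M₁₁
  B (R₁ j (suc d) e) = R₀ (suc j) d (trans (sym (+-suc j d)) e)
  B M₀ = F₁ m 0 (+-identityʳ m)
  B M₁₁ = R₁ m 0 (+-identityʳ m)
  B M₁ = M₂
  B M₂ = M₁
  B M₃ = M₄
  B M₄ = M₃
  B M₅ = M₆
  B M₆ = M₅
  B M₇ = M₈
  B M₈ = M₇
  B M₉ = M₁₀
  B M₁₀ = M₉

  C s₀ = s₀
  C t = t
  C s₁ = s₂
  C s₂ = s₁
  C (F₀ j d e) = F₁ j d e
  C (F₁ j d e) = F₀ j d e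
  C (R₀ j d e) = R₁ j d e
  C (R₁ j d e) = R₀ j d e
  C (G₀ j d e) = G₁ j d e
  C (G₁ j d e) = G₀ j d e
  C (G₂ j d e) = G₃ j d e
  C (G₃ j d e) = G₂ j d e
  C M₀ = M₁
  C M₁ = M₀
  C M₂ = M₃
  C M₃ = M₂
  C M₄ = M₅
  C M₅ = M₄
  C M₆ = M₇
  C M₇ = M₆
  C M₈ = M₉
  C M₉ = M₈
  C M₁₀ = M₁₁
  C M₁₁ = M₁₀

  A-invol : ∀ x → A (A x) ≡ x
  A-invol s₀ = refl
  A-invol s₁ = refl
  A-invol s₂ = refl
  A-invol t = refl
  A-invol (F₀ j d e) = refl
  A-invol (F₁ j d e) = refl
  A-invol (R₀ j d e) = refl
  A-invol (R₁ j d e) = refl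
  A-invol (G₀ j d e) = refl
  A-invol (G₁ j d e) = refl
  A-invol (G₂ j d e) = refl
  A-invol (G₃ j d e) = refl
  A-invol M₀ = refl
  A-invol M₁ = refl
  A-invol M₂ = refl
  A-invol M₃ = refl
  A-invol M₄ = refl
  A-invol M₅ = refl
  A-invol M₆ = refl
  A-invol M₇ = refl
  A-invol M₈ = refl
  A-invol M₉ = refl
  A-invol M₁₀ = refl
  A-invol M₁₁ = refl

  B-invol : ∀ x → B (B x) ≡ x
  B-invol s₀ = refl
  B-invol s₁ = refl
  B-invol s₂ = refl
  B-invol t = refl
  B-invol (F₀ zero d e) = strand-≡ F₀ refl (first-on-strand e)
  B-invol (F₀ (suc j) d e) = refl
  B-invol (F₁ j zero e) = strand-≡ F₁ (last-on-strand e) refl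
  B-invol (F₁ j (suc d) e) = refl
  B-invol (R₀ zero d e) = strand-≡ R₀ refl (first-on-strand e)
  B-invol (R₀ (suc j) d e) = refl
  B-invol (R₁ j zero e) = strand-≡ R₁ (last-on-strand e) refl
  B-invol (R₁ j (suc d) e) = refl
  B-invol (G₀ j d e) = refl
  B-invol (G₁ j d e) = refl
  B-invol (G₂ j d e) = refl
  B-invol (G₃ j d e) = refl
  B-invol M₀ = refl
  B-invol M₁ = refl
  B-invol M₂ = refl
  B-invol M₃ = refl
  B-invol M₄ = refl
  B-invol M₅ = refl
  B-invol M₆ = refl
  B-invol M₇ = refl
  B-invol M₈ = refl
  B-invol M₉ = refl
  B-invol M₁₀ = refl
  B-invol M₁₁ = refl

  C-invol : ∀ x → C (C x) ≡ x
  C-invol s₀ = refl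
  C-invol s₁ = refl
  C-invol s₂ = refl
  C-invol t = refl
  C-invol (F₀ j d e) = refl
  C-invol (F₁ j d e) = refl
  C-invol (R₀ j d e) = refl
  C-invol (R₁ j d e) = refl
  C-invol (G₀ j d e) = refl
  C-invol (G₁ j d e) = refl
  C-invol (G₂ j d e) = refl
  C-invol (G₃ j d e) = refl
  C-invol M₀ = refl
  C-invol M₁ = refl
  C-invol M₂ = refl
  C-invol M₃ = refl
  C-invol M₄ = refl
  C-invol M₅ = refl
  C-invol M₆ = refl
  C-invol M₇ = refl
  C-invol M₈ = refl
  C-invol M₉ = refl
  C-invol M₁₀ = refl
  C-invol M₁₁ = refl

  ac-squared : ∀ x → C (A (C (A x))) ≡ x
  ac-squared s₀ = refl
  ac-squared s₁ = refl
  ac-squared s₂ = refl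
  ac-squared t = refl
  ac-squared (F₀ j d e) = refl
  ac-squared (F₁ j d e) = refl
  ac-squared (R₀ j d e) = refl
  ac-squared (R₁ j d e) = refl
  ac-squared (G₀ j d e) = refl
  ac-squared (G₁ j d e) = refl
  ac-squared (G₂ j d e) = refl
  ac-squared (G₃ j d e) = refl
  ac-squared M₀ = refl
  ac-squared M₁ = refl
  ac-squared M₂ = refl
  ac-squared M₃ = refl
  ac-squared M₄ = refl
  ac-squared M₅ = refl
  ac-squared M₆ = refl
  ac-squared M₇ = refl
  ac-squared M₈ = refl
  ac-squared M₉ = refl
  ac-squared M₁₀ = refl
  ac-squared M₁₁ = refl

  ab-cubed : ∀ x → B (A (B (A (B (A x))))) ≡ x
  ab-cubed s₀ = refl
  ab-cubed s₁ = refl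
  ab-cubed s₂ = refl
  ab-cubed t = refl
  ab-cubed (F₀ zero d e) = strand-≡ F₀ refl (first-on-strand e)
  ab-cubed (F₀ (suc j) d e) = refl
  ab-cubed (F₁ j zero e) = strand-≡ F₁ (last-on-strand e) refl
  ab-cubed (F₁ j (suc d) e) = refl
  ab-cubed (R₀ zero d e) = strand-≡ R₀ refl (first-on-strand e)
  ab-cubed (R₀ (suc j) d e) = refl
  ab-cubed (R₁ j zero e) = strand-≡ R₁ (last-on-strand e) refl
  ab-cubed (R₁ j (suc d) e) = refl
  ab-cubed (G₀ j d e) = refl
  ab-cubed (G₁ j d e) = refl
  ab-cubed (G₂ j d e) = refl
  ab-cubed (G₃ j d e) = refl
  ab-cubed M₀ = refl
  ab-cubed M₁ = refl
  ab-cubed M₂ = refl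
  ab-cubed M₃ = refl
  ab-cubed M₄ = refl
  ab-cubed M₅ = refl
  ab-cubed M₆ = refl
  ab-cubed M₇ = refl
  ab-cubed M₈ = refl
  ab-cubed M₉ = refl
  ab-cubed M₁₀ = refl
  ab-cubed M₁₁ = refl

  act : Fin 3 → Point m → Point m
  act zero = A
  act (suc zero) = B
  act (suc (suc zero)) = C

  act-invol : ∀ i x → act i (act i x) ≡ x
  act-invol zero = A-invol
  act-invol (suc zero) = B-invol
  act-invol (suc (suc zero)) = C-invol

  open Action act act-invol public

  half : ℕ
  half = 10 + m * 4

  order : ℕ
  order = half + half

  -- The bc-orbit of s₀: s₀, s₂, then the strands F₁, G₁, G₃ interleaved by
  -- position, the odd M's, the strand R₀, t, the strand R₁, the even M's, the
  -- strands F₀, G₂, G₀ interleaved by distance, and finally s₁.  The label of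
  -- a point is its position on this walk; k₀, k₁, k₂ are the positions at
  -- which the walk enters R₀, R₁ and F₀.
  bc cb : Point m → Point m
  bc x = C (B x)
  cb x = B (C x)

  bc∘cb : ∀ x → bc (cb x) ≡ x
  bc∘cb x = trans (cong C (B-invol (C x))) (C-invol x)

  k₀ k₁ k₂ : ℕ
  k₀ = 9 + m * 3
  k₁ = 2 + (m + k₀)
  k₂ = 7 + (m + k₁)

  bc-label : Point m → ℕ
  bc-label s₀ = 0
  bc-label s₂ = 1
  bc-label (F₁ j d e) = 2 + j * 3
  bc-label (G₁ j d e) = 3 + j * 3
  bc-label (G₃ j d e) = 4 + j * 3
  bc-label M₁ = 3 + m * 3
  bc-label M₃ = 4 + m * 3
  bc-label M₅ = 5 + m * 3
  bc-label M₇ = 6 + m * 3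
  bc-label M₉ = 7 + m * 3
  bc-label M₁₁ = 8 + m * 3
  bc-label (R₀ j d e) = d + k₀
  bc-label t = suc (m + k₀)
  bc-label (R₁ j d e) = j + k₁
  bc-label M₁₀ = 1 + (m + k₁)
  bc-label M₈ = 2 + (m + k₁)
  bc-label M₆ = 3 + (m + k₁)
  bc-label M₄ = 4 + (m + k₁)
  bc-label M₂ = 5 + (m + k₁)
  bc-label M₀ = 6 + (m + k₁)
  bc-label (F₀ j d e) = d * 3 + k₂
  bc-label (G₂ j d e) = 1 + (d * 3 + k₂)
  bc-label (G₀ j d e) = 2 + (d * 3 + k₂)
  bc-label s₁ = suc (m * 3 + k₂)

  bc-step : ∀ x → x ≡ s₁ ⊎ bc-label (bc x) ≡ suc (bc-label x)
  bc-step s₀ = inj₂ refl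
  bc-step s₁ = inj₁ refl
  bc-step s₂ = inj₂ refl
  bc-step t = inj₂ refl
  bc-step (F₀ zero d e) = inj₂ (cong (λ z → suc (z * 3 + k₂)) (first-on-strand e))
  bc-step (F₀ (suc j) d e) = inj₂ refl
  bc-step (F₁ j zero e) = inj₂ (cong (λ z → 3 + z * 3) (last-on-strand e))
  bc-step (F₁ j (suc d) e) = inj₂ refl
  bc-step (R₀ zero d e) = inj₂ (cong (λ z → suc (z + k₀)) (first-on-strand e))
  bc-step (R₀ (suc j) d e) = inj₂ refl
  bc-step (R₁ j zero e) = inj₂ (cong (λ z → suc (z + k₁)) (last-on-strand e))
  bc-step (R₁ j (suc d) e) = inj₂ refl
  bc-step (G₀ j d e) = inj₂ refl
  bc-step (G₁ j d e) = inj₂ refl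
  bc-step (G₂ j d e) = inj₂ refl
  bc-step (G₃ j d e) = inj₂ refl
  bc-step M₀ = inj₂ refl
  bc-step M₁ = inj₂ refl
  bc-step M₂ = inj₂ refl
  bc-step M₃ = inj₂ refl
  bc-step M₄ = inj₂ refl
  bc-step M₅ = inj₂ refl
  bc-step M₆ = inj₂ refl
  bc-step M₇ = inj₂ refl
  bc-step M₈ = inj₂ refl
  bc-step M₉ = inj₂ refl
  bc-step M₁₀ = inj₂ refl
  bc-step M₁₁ = inj₂ refl

  module BC = LabelledCycle bc cb bc∘cb bc-label s₀ s₁ refl bc-step refl

  bc-length : BC.length ≡ order
  bc-length = arithmetic m
    where
      arithmetic : ∀ m → 2 + (m * 3 + (7 + (m + (2 + (m + (9 + m * 3)))))) ≡
                         (10 + m * 4) + (10 + m * 4)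
      arithmetic = solve-∀

  -- The bac-orbit of s₀ runs through s₁, t, then alternately along F₁ and R₁
  -- (each F₁ point followed by G₂ and G₃), through the M's, then alternately
  -- along F₀ and R₀ (each F₀ point followed by G₁ and G₀), and closes at
  -- R₀ 0 m.  The alternation is recorded by the zigzag counters started at 3
  -- and 2 + half.
  bac cab : Point m → Point m
  bac x = C (A (B x))
  cab x = B (A (C x))

  bac∘cab : ∀ x → bac (cab x) ≡ x
  bac∘cab x = begin
    C (A (B (B (A (C x))))) ≡⟨ cong (λ z → C (A z)) (B-invol (A (C x))) ⟩
    C (A (A (C x)))         ≡⟨ cong C (A-invol (C x)) ⟩
    C (C x)                 ≡⟨ C-invol x ⟩
    x                       ∎

  open Zigzag 3 (2 + half)

  bac-label : Point m → ℕ
  bac-label s₀ = 0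
  bac-label s₁ = 1
  bac-label t = 2
  bac-label s₂ = suc half
  bac-label (F₁ j d e) = zigF j
  bac-label (G₂ j d e) = 1 + zigF j
  bac-label (G₃ j d e) = 2 + zigF j
  bac-label (R₁ j d e) = zigR j
  bac-label (F₀ j d e) = 7 + zigF (d + m)
  bac-label (G₁ j d e) = 8 + zigF (d + m)
  bac-label (G₀ j d e) = 9 + zigF (d + m)
  bac-label (R₀ j d e) = 7 + zigR (d + m)
  bac-label M₅ = 1 + zigF m
  bac-label M₈ = 2 + zigF m
  bac-label M₉ = 3 + zigF m
  bac-label M₃ = 4 + zigF m
  bac-label M₁ = 5 + zigF m
  bac-label M₁₁ = 6 + zigF m
  bac-label M₂ = 1 + zigR m
  bac-label M₄ = 2 + zigR m
  bac-label M₁₀ = 3 + zigR m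
  bac-label M₇ = 4 + zigR m
  bac-label M₆ = 5 + zigR m
  bac-label M₀ = 6 + zigR m

  bac-label-F₀-first : 7 + zigF (m + m) ≡ half
  bac-label-F₀-first = begin
    7 + zigF (m + m)  ≡⟨ cong (7 +_) (proj₁ (zig-double m)) ⟩
    7 + (m * 4 + 3)   ≡⟨ arithmetic m ⟩
    10 + m * 4        ∎
    where
      arithmetic : ∀ m → 7 + (m * 4 + 3) ≡ 10 + m * 4
      arithmetic = solve-∀

  bac-step : ∀ x → x ≡ R₀ 0 m refl ⊎ bac-label (bac x) ≡ suc (bac-label x)
  bac-step s₀ = inj₂ refl
  bac-step s₁ = inj₂ refl
  bac-step s₂ = inj₂ refl
  bac-step t = inj₂ refl
  bac-step (F₀ zero d e) = inj₂ (cong suc (begin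
    half              ≡⟨ bac-label-F₀-first ⟨
    7 + zigF (m + m)  ≡⟨ cong (λ z → 7 + zigF (z + m)) (first-on-strand e) ⟩
    7 + zigF (d + m)  ∎))
  bac-step (F₀ (suc j) d e) = inj₂ refl
  bac-step (F₁ j zero e) = inj₂ (cong (λ z → suc (zigF z)) (last-on-strand e))
  bac-step (F₁ j (suc d) e) = inj₂ refl
  bac-step (R₀ zero d e) = inj₁ (strand-≡ R₀ refl (sym (first-on-strand e)))
  bac-step (R₀ (suc j) d e) = inj₂ refl
  bac-step (R₁ j zero e) = inj₂ (cong (λ z → suc (zigR z)) (last-on-strand e))
  bac-step (R₁ j (suc d) e) = inj₂ refl
  bac-step (G₀ j d e) = inj₂ refl
  bac-step (G₁ j d e) = inj₂ refl
  bac-step (G₂ j d e) = inj₂ refl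
  bac-step (G₃ j d e) = inj₂ refl
  bac-step M₀ = inj₂ refl
  bac-step M₁ = inj₂ refl
  bac-step M₂ = inj₂ refl
  bac-step M₃ = inj₂ refl
  bac-step M₄ = inj₂ refl
  bac-step M₅ = inj₂ refl
  bac-step M₆ = inj₂ refl
  bac-step M₇ = inj₂ refl
  bac-step M₈ = inj₂ refl
  bac-step M₉ = inj₂ refl
  bac-step M₁₀ = inj₂ refl
  bac-step M₁₁ = inj₂ refl

  module BAC = LabelledCycle bac cab bac∘cab bac-label s₀ (R₀ 0 m refl) refl bac-step refl

  bac-length : BAC.length ≡ order
  bac-length = begin
    8 + zigR (m + m)                  ≡⟨ cong (8 +_) (proj₂ (zig-double m)) ⟩
    8 + (m * 4 + (2 + (10 + m * 4)))  ≡⟨ arithmetic m ⟩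
    (10 + m * 4) + (10 + m * 4)       ∎
    where
      arithmetic : ∀ m → 8 + (m * 4 + (2 + (10 + m * 4))) ≡ (10 + m * 4) + (10 + m * 4)
      arithmetic = solve-∀

  relators-trivial : ∀ r → r ∈ relH order → ActsTrivially r
  relators-trivial r (here refl) = A-invol
  relators-trivial r (there (here refl)) = B-invol
  relators-trivial r (there (there (here refl))) = C-invol
  relators-trivial r (there (there (there (here refl)))) = ab-cubed
  relators-trivial r (there (there (there (there (here refl))))) = ac-squared
  relators-trivial r (there (there (there (there (there (here refl)))))) x =
    trans (ev-^w (b ++ c) order x)
          (subst (λ n → iterate bc x n ≡ x) bc-length (BC.period x))
  relators-trivial r (there (there (there (there (there (there (here refl))))))) x =
    trans (ev-^w (b ++ (a ++ c)) order x)
          (subst (λ n → iterate bac x n ≡ x) bac-length (BAC.period x))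

four-times-odd-uncollapsed : ∀ m → Uncollapsed (4 * (5 + m * 2))
four-times-odd-uncollapsed m = subst Uncollapsed (arithmetic m)
  (uncollapsed-by-action order relators-trivial s₀ λ k 1≤k k<order →
     BC.returns-late k 1≤k (subst (k <_) (sym bc-length) k<order))
  where
    open Representation m
    arithmetic : ∀ m → (10 + m * 4) + (10 + m * 4) ≡ 4 * (5 + m * 2)
    arithmetic = solve-∀

parity : ∀ n → ∃ λ i → n ≡ i * 2 ⊎ n ≡ suc (i * 2)
parity zero = 0 , inj₁ refl
parity (suc n) with parity n
... | i , inj₁ refl = i , inj₂ refl
... | i , inj₂ refl = suc i , inj₁ refl

prime>3-odd : ∀ p → Prime p → 3 < p → ∃ λ m → p ≡ 5 + m * 2
prime>3-odd p p-prime 3<p with parity p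
... | i , inj₁ refl =
  contradiction (composite {2} (<⇒≤ 3<p) (divides i refl)) (Prime.notComposite p-prime)
... | zero , inj₂ refl = contradiction 3<p λ { (s≤s ()) }
... | suc zero , inj₂ refl = contradiction 3<p (<-irrefl refl)
... | suc (suc m) , inj₂ refl = m , refl

proposition6p16 : ∀ (p : ℕ) → Prime p → 3 < p → Uncollapsed (4 * p)
proposition6p16 p p-prime 3<p with prime>3-odd p p-prime 3<p
... | m , refl = four-times-odd-uncollapsed m
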